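{- Let $p,q>1$ be relatively prime integers. For every integer $U$, $$\Omega(U)=\Omega^*(U)+{}^1\Omega^*(U-1),\qquad \Omega^*(U)={}^p\Omega(U/p)\cup{}^q\Omega(U/q),$$ where $+$ denotes disjoint union.
   Context: A strictly chained $(p,q)$-ary partition of $U$ is a finite sequence of distinct positive integers of the form $p^aq^b$ ($a,b\ge 0$) summing to $U$, written in decreasing order, such that each part is a multiple of the next one. $\Omega(U)$ denotes the set of such partitions of $U$, and $\Omega^*(U)$ the subset of those with no part equal to $1$. By convention $\Omega(0)=\{()\}$ (the empty sequence), and $\Omega(x)=\emptyset$ whenever $x$ is not a nonnegative integer. For a set $\Omega$ of such partitions: ${}^p\Omega$ (resp. ${}^q\Omega$) is the set obtained by multiplying every part of every partition by $p$ (resp. $q$); ${}^1\Omega$ is obtained as follows: if $\min(p,q)=2$, for each partition increase its binary amount (the sum of its parts that are powers of $2$, or $0$ if none) by $1$, i.e. replace its power-of-$2$ parts by the binary expansion of (binary amount $+1$); if $\min(p,q)>2$, append a part $1$ to each partition. (The results are general partitions, i.e. non-increasing sequences of positive integers.) -}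

module Defs where

open import Data.Nat using (ℕ; zero; suc; _+_; _*_; _^_; _<_; _⊓_; _≤ᵇ_; _/_; _%_)
open import Data.Nat.Properties using (_≟_)
open import Data.Nat.Divisibility using (_∣_)
open import Data.Integer using (ℤ; +_)
open import Data.Fin using (Fin; toℕ)
open import Data.Fin.Properties using (any?)
open import Data.List using (List; []; _∷_; _++_; [_]; filter; foldr)
open import Data.Nat.ListAction using (sum)
open import Data.List.Relation.Unary.All using (All)
open import Data.List.Relation.Unary.Linked using (Linked)
open import Data.List.Membership.Propositional using (_∈_)
open import Data.Product using (Σ; ∃; _×_)
open import Data.Sum using (_⊎_)
open import Data.Bool using (Bool; if_then_else_)
open import Relation.Nullary using (¬_; Dec; ¬?; does)
open import Relation.Binary.PropositionalEquality using (_≡_)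

-- a partition is a list of naturals; a "set of partitions" is a predicate
PSet : Set₁
PSet = List ℕ → Set

IsPQ : ℕ → ℕ → ℕ → Set
IsPQ p q x = Σ ℕ λ a → Σ ℕ λ b → x ≡ p ^ a * q ^ b

ChainRel : ℕ → ℕ → Set
ChainRel x y = (y < x) × (y ∣ x)

SCP : ℕ → ℕ → ℕ → List ℕ → Set
SCP p q n l = All (λ x → 0 < x) l × All (IsPQ p q) l × Linked ChainRel l × sum l ≡ n

-- Ω(U) for an integer U (empty when U is negative)
Ω : ℕ → ℕ → ℤ → PSet
Ω p q U l = Σ ℕ λ n → (U ≡ + n) × SCP p q n l

Ω* : ℕ → ℕ → ℤ → PSet
Ω* p q U l = Ω p q U l × ¬ (1 ∈ l)

-- Ω(U/d) for d > 0: nonempty only if U/d is a nonnegative integer n, i.e. U = d*n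
ΩDiv : ℕ → ℕ → ℤ → ℕ → PSet
ΩDiv p q U d l = Σ ℕ λ n → (U ≡ + (d * n)) × SCP p q n l

Image : (List ℕ → List ℕ) → PSet → PSet
Image f S l = Σ (List ℕ) λ l′ → S l′ × (l ≡ f l′)

scale : ℕ → List ℕ → List ℕ
scale m = Data.List.map (m *_)

-- decidable "is a power of 2" (2^k = n forces k < n+1)
isPow2? : (n : ℕ) → Dec (∃ λ (k : Fin (suc n)) → n ≡ 2 ^ toℕ k)
isPow2? n = any? (λ k → n ≟ 2 ^ toℕ k)

-- binary expansion: the distinct powers of 2 summing to n (fuel-bounded; fuel n suffices)
binExpAux : ℕ → ℕ → ℕ → List ℕ
binExpAux zero w n = []
binExpAux (suc f) w n = (if does (n % 2 ≟ 1) then [ w ] else []) ++ binExpAux f (2 * w) (n / 2)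

binExp : ℕ → List ℕ
binExp n = binExpAux n 1 n

insertDesc : ℕ → List ℕ → List ℕ
insertDesc x [] = x ∷ []
insertDesc x (y ∷ ys) = if x ≤ᵇ y then y ∷ insertDesc x ys else x ∷ y ∷ ys

sortDesc : List ℕ → List ℕ
sortDesc = foldr insertDesc []

binaryAmount : List ℕ → ℕ
binaryAmount l = sum (filter isPow2? l)

one : ℕ → ℕ → List ℕ → List ℕ
one p q l = if does (p ⊓ q ≟ 2)
  then sortDesc (filter (λ x → ¬? (isPow2? x)) l ++ binExp (suc (binaryAmount l)))
  else l ++ [ 1 ]

_≐_ : PSet → PSet → Set
A ≐ B = ∀ l → (A l → B l) × (B l → A l)

_∪_ : PSet → PSet → PSet
(A ∪ B) l = A l ⊎ B l

IsDisjointUnion : PSet → PSet → PSet → Set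
IsDisjointUnion A B C = (A ≐ (B ∪ C)) × (∀ l → ¬ (B l × C l))

module Submission where

-- First decomposition: a strictly chained partition has a part 1 only as its last part,
-- so it either lies in Ω*(U) or is l ++ [1] with l ∈ Ω*(U-1).  The heart of the proof is
-- that ^1 applied to l ∈ Ω*(U-1) is exactly l ++ [1] (one-appends-one).  When min(p,q) > 2
-- this is the definition; when, say, p = 2, the powers of two in l form a final segment
-- (a (2,q)-number dividing a power of two is a power of two), so increasing the binary
-- amount by one just adds the part 1 — which rests on the uniqueness of binary expansions
-- (binExp-powers), proved digit by digit on lists of exponents (binExpAux-powers).
-- Second decomposition: every part of l ∈ Ω*(U) is a multiple of its smallest part p^a q^b ≠ 1,
-- hence all parts are divisible by p or all by q (common-factor), and dividing or
-- multiplying all parts by p (or q) preserves strict chains of (p,q)-numbers (Scaling).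

open import Defs
open import Data.Bool using (if_then_else_)
open import Data.Fin using (Fin; toℕ; fromℕ<)
open import Data.Fin.Properties using (toℕ-fromℕ<)
open import Data.Integer using (ℤ; +_; -[1+_]; _-_)
open import Data.List using (List; []; _∷_; _++_; [_]; map; reverse; reverseAcc; filter)
open import Data.List.Membership.Propositional using (_∈_)
open import Data.List.Membership.Propositional.Properties using (∈-++⁺ʳ)
open import Data.List.Properties
  using (unfold-reverse; reverse-involutive; reverse-map; map-∘; map-cong;
         filter-all; filter-none; filter-accept; filter-reject)
open import Data.List.Relation.Binary.Permutation.Propositional.Properties using (↭-reverse)
open import Data.List.Relation.Unary.All as All using (All; []; _∷_)
import Data.List.Relation.Unary.All.Properties as All
open import Data.List.Relation.Unary.Any using (here; there)
import Data.List.Relation.Unary.Any.Properties as Any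
open import Data.List.Relation.Unary.Linked as Linked using (Linked; []; [-]; _∷_)
import Data.List.Relation.Unary.Linked.Properties as Linked
open import Data.Nat
open import Data.Nat.Properties
open import Data.List.Membership.DecPropositional _≟_ using (_∈?_)
open import Data.Nat.Coprimality as Coprimality using (Coprime; coprime-divisor)
open import Data.Nat.Divisibility
  using (_∣_; divides; divides-refl; ∣1⇒≡1; ∣-trans; m∣m*n; n∣m*n; 1∣_; *-monoʳ-∣; *-cancelˡ-∣)
open import Data.Nat.DivMod using (m*n%n≡0; m*n/n≡m; [m+kn]%n≡m%n; +-distrib-/-∣ʳ)
open import Data.Nat.ListAction using (sum)
open import Data.Nat.ListAction.Properties using (sum-++; sum-↭)
open import Data.Product using (Σ; ∃; _×_; _,_; proj₁; proj₂)
open import Data.Sum using (_⊎_; inj₁; inj₂)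
open import Function using (flip; _∘_; _∘′_)
open import Relation.Binary.Definitions using (Transitive)
open import Relation.Nullary using (¬_; ¬?; Dec; yes; no; does; contradiction)
open import Relation.Nullary.Decidable using (dec-true; dec-false)
open import Relation.Binary.PropositionalEquality hiding ([_])
open ≡-Reasoning

head-relates : ∀ {A : Set} {R : A → A → Set} → Transitive R →
               ∀ {x xs} → Linked R (x ∷ xs) → All (R x) xs
head-relates trans [-] = []
head-relates trans (r ∷ l) = Linked.Linked⇒All trans r l

reverseAcc⁺ : ∀ {A : Set} {R : A → A → Set} {x} xs acc →
              Linked R (x ∷ xs) → Linked (flip R) (x ∷ acc) →
              Linked (flip R) (reverseAcc acc (x ∷ xs))
reverseAcc⁺ []       acc _       racc = racc
reverseAcc⁺ (y ∷ ys) acc (r ∷ l) racc = reverseAcc⁺ ys _ l (r ∷ racc)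

reverse⁺ : ∀ {A : Set} {R : A → A → Set} {xs} → Linked R xs → Linked (flip R) (reverse xs)
reverse⁺ {xs = []}     _ = []
reverse⁺ {xs = x ∷ xs} l = reverseAcc⁺ xs [] l [-]

All-reverse : ∀ {A : Set} {P : A → Set} {xs} → All P xs → All P (reverse xs)
All-reverse pxs = All.tabulate (λ x∈ → All.lookup pxs (Any.reverse⁻ x∈))

Linked-prefix : ∀ {A : Set} {R : A → A → Set} xs {ys} → Linked R (xs ++ ys) → Linked R xs
Linked-prefix []           _       = []
Linked-prefix (x ∷ [])     _       = [-]
Linked-prefix (x ∷ y ∷ xs) (r ∷ l) = r ∷ Linked-prefix (y ∷ xs) l

Linked-snoc : ∀ {A : Set} {R : A → A → Set} {xs y} →
              Linked R xs → All (λ z → R z y) xs → Linked R (xs ++ [ y ])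
Linked-snoc []      []       = [-]
Linked-snoc [-]     (r ∷ []) = r ∷ [-]
Linked-snoc (r ∷ l) (_ ∷ rs) = r ∷ Linked-snoc l rs

sum-scale : ∀ r xs → sum (map (r *_) xs) ≡ r * sum xs
sum-scale r []       = sym (*-zeroʳ r)
sum-scale r (x ∷ xs) = begin
  r * x + sum (map (r *_) xs) ≡⟨ cong (λ s → r * x + s) (sum-scale r xs) ⟩
  r * x + r * sum xs          ≡⟨ *-distribˡ-+ r x (sum xs) ⟨
  r * (x + sum xs)            ∎

insertDesc-front : ∀ x D → All (_< x) D → insertDesc x D ≡ x ∷ D
insertDesc-front x []      []          = refl
insertDesc-front x (y ∷ D) (y<x ∷ _) rewrite dec-false (x ≤? y) (<⇒≱ y<x) = refl

insertDesc-back : ∀ x D → All (x ≤_) D → insertDesc x D ≡ D ++ [ x ]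
insertDesc-back x []      []          = refl
insertDesc-back x (y ∷ D) (x≤y ∷ x≤D) rewrite dec-true (x ≤? y) x≤y =
  cong (y ∷_) (insertDesc-back x D x≤D)

sortDesc-ascending : ∀ A → Linked _<_ A → sortDesc A ≡ reverse A
sortDesc-ascending []      _ = refl
sortDesc-ascending (a ∷ A) l = begin
  insertDesc a (sortDesc A)  ≡⟨ cong (insertDesc a) (sortDesc-ascending A (Linked.tail l)) ⟩
  insertDesc a (reverse A)   ≡⟨ insertDesc-back a (reverse A) (All-reverse (All.map <⇒≤ (head-relates <-trans l))) ⟩
  reverse A ++ [ a ]         ≡⟨ unfold-reverse a A ⟨
  reverse (a ∷ A)            ∎

binExpAux-digit : ∀ f w n {d h} → n % 2 ≡ d → n / 2 ≡ h →
                  binExpAux (suc f) w n ≡ (if does (d ≟ 1) then [ w ] else []) ++ binExpAux f (2 * w) h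
binExpAux-digit f w n refl refl = refl

binExpAux-even : ∀ f w S → binExpAux (suc f) w (2 * S) ≡ binExpAux f (2 * w) S
binExpAux-even f w S = binExpAux-digit f w (2 * S)
  (trans (cong (_% 2) (*-comm 2 S)) (m*n%n≡0 S 2))
  (trans (cong (_/ 2) (*-comm 2 S)) (m*n/n≡m S 2))

binExpAux-odd : ∀ f w S → binExpAux (suc f) w (1 + 2 * S) ≡ w ∷ binExpAux f (2 * w) S
binExpAux-odd f w S = binExpAux-digit f w (1 + 2 * S)
  (trans (cong (λ n → (1 + n) % 2) (*-comm 2 S)) ([m+kn]%n≡m%n 1 S 2))
  (trans (cong (λ n → (1 + n) / 2) (*-comm 2 S))
         (trans (+-distrib-/-∣ʳ 1 {d = 2} (divides-refl S)) (m*n/n≡m S 2)))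

sum-pow-shift : ∀ E → sum (map (2 ^_) (map suc E)) ≡ 2 * sum (map (2 ^_) E)
sum-pow-shift E = begin
  sum (map (2 ^_) (map suc E))    ≡⟨ cong sum (map-∘ E) ⟨
  sum (map ((2 ^_) ∘ suc) E)      ≡⟨ cong sum (map-∘ E) ⟩
  sum (map (2 *_) (map (2 ^_) E)) ≡⟨ sum-scale 2 (map (2 ^_) E) ⟩
  2 * sum (map (2 ^_) E)         ∎

map-suc-pred : ∀ {E} → All (0 <_) E → map suc (map pred E) ≡ E
map-suc-pred []          = refl
map-suc-pred (z<s ∷ pos) = cong (_ ∷_) (map-suc-pred pos)

-- The lowest binary digit of a sum of distinct powers of two: a strictly
-- increasing list of exponents either has no zero or starts with zero.
lowest-digit : ∀ E → Linked _<_ E →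
               Σ (List ℕ) λ E′ → (E ≡ map suc E′) ⊎ (E ≡ 0 ∷ map suc E′)
lowest-digit []          _ = [] , inj₁ refl
lowest-digit (zero ∷ E)  l =
  map pred E , inj₂ (cong (0 ∷_) (sym (map-suc-pred (head-relates <-trans l))))
lowest-digit (suc e ∷ E) l =
  map pred (suc e ∷ E) ,
  inj₁ (sym (map-suc-pred (z<s ∷ All.map (<-trans z<s) (head-relates <-trans l))))

Linked-unshift : ∀ {E} → Linked _<_ (map suc E) → Linked _<_ E
Linked-unshift l = Linked.map s<s⁻¹ (Linked.map⁻ l)

doubled-weights : ∀ {w} E → map (λ e → 2 * w * 2 ^ e) E ≡ map (λ e → w * 2 ^ e) (map suc E)
doubled-weights {w} E = trans (map-cong reassociate E) (map-∘ E)
  where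
  reassociate : ∀ e → 2 * w * 2 ^ e ≡ w * 2 ^ suc e
  reassociate e = trans (cong (_* 2 ^ e) (*-comm 2 w)) (*-assoc w 2 (2 ^ e))

binExpAux-powers : ∀ f w E → Linked _<_ E → sum (map (2 ^_) E) < 2 ^ f →
                   binExpAux f w (sum (map (2 ^_) E)) ≡ map (λ e → w * 2 ^ e) E
binExpAux-powers zero    w []      _ _  = refl
binExpAux-powers zero    w (e ∷ E) _ (s≤s bound) =
  contradiction (≤-trans (m^n>0 2 e) (m≤m+n (2 ^ e) _)) (<⇒≱ (s≤s bound))
binExpAux-powers (suc f) w E l bound with lowest-digit E l
... | E′ , inj₁ refl = begin
  binExpAux (suc f) w (sum (map (2 ^_) (map suc E′))) ≡⟨ cong (binExpAux (suc f) w) (sum-pow-shift E′) ⟩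
  binExpAux (suc f) w (2 * S)                          ≡⟨ binExpAux-even f w S ⟩
  binExpAux f (2 * w) S                                ≡⟨ binExpAux-powers f (2 * w) E′ (Linked-unshift l) halved ⟩
  map (λ e → 2 * w * 2 ^ e) E′                         ≡⟨ doubled-weights {w} E′ ⟩
  map (λ e → w * 2 ^ e) (map suc E′)                   ∎
  where
  S : ℕ
  S = sum (map (2 ^_) E′)
  halved : S < 2 ^ f
  halved = *-cancelˡ-< 2 S (2 ^ f) (subst (_< 2 ^ suc f) (sum-pow-shift E′) bound)
... | E′ , inj₂ refl = begin
  binExpAux (suc f) w (1 + sum (map (2 ^_) (map suc E′))) ≡⟨ cong (binExpAux (suc f) w ∘ suc) (sum-pow-shift E′) ⟩
  binExpAux (suc f) w (1 + 2 * S)                          ≡⟨ binExpAux-odd f w S ⟩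
  w ∷ binExpAux f (2 * w) S                                ≡⟨ cong₂ _∷_ (sym (*-identityʳ w))
                                                                 (binExpAux-powers f (2 * w) E′ (Linked-unshift (Linked.tail l)) halved) ⟩
  w * 1 ∷ map (λ e → 2 * w * 2 ^ e) E′                     ≡⟨ cong (w * 1 ∷_) (doubled-weights {w} E′) ⟩
  w * 1 ∷ map (λ e → w * 2 ^ e) (map suc E′)               ∎
  where
  S : ℕ
  S = sum (map (2 ^_) E′)
  halved : S < 2 ^ f
  halved = *-cancelˡ-< 2 S (2 ^ f)
    (≤-<-trans (n≤1+n (2 * S)) (subst (λ n → 1 + n < 2 ^ suc f) (sum-pow-shift E′) bound))

-- Every exponent is below its power of two, so fuel n suffices to expand n.
n<2^n : ∀ n → n < 2 ^ n
n<2^n zero    = z<s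
n<2^n (suc n) = +-mono-≤ (m^n>0 2 n) (subst (suc n ≤_) (sym (+-identityʳ (2 ^ n))) (n<2^n n))

Pow2 : ℕ → Set
Pow2 x = Σ ℕ λ k → x ≡ 2 ^ k

exponents : ∀ {X} → All Pow2 X → Σ (List ℕ) λ D → X ≡ map (2 ^_) D
exponents []               = [] , refl
exponents ((k , refl) ∷ pw) = k ∷ proj₁ (exponents pw) , cong (2 ^ k ∷_) (proj₂ (exponents pw))

2^-cancel-< : ∀ {a b} → 2 ^ a < 2 ^ b → a < b
2^-cancel-< 2^a<2^b = ≰⇒> (λ b≤a → <⇒≱ 2^a<2^b (^-monoʳ-≤ 2 b≤a))

-- Uniqueness of binary expansion: sorting the binary expansion of the sum of a
-- strictly decreasing list of powers of two gives back that list.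
binExp-powers : ∀ X → All Pow2 X → Linked _>_ X → sortDesc (binExp (sum X)) ≡ X
binExp-powers X pw decreasing with exponents pw
... | D , refl = begin
  sortDesc (binExpAux n 1 n)                   ≡⟨ cong (sortDesc ∘ binExpAux n 1) sum-E ⟨
  sortDesc (binExpAux n 1 (sum (map (2 ^_) E))) ≡⟨ cong sortDesc (binExpAux-powers n 1 E E-ascending bound) ⟩
  sortDesc (map (λ e → 1 * 2 ^ e) E)           ≡⟨ cong sortDesc (trans (map-cong (λ e → *-identityˡ (2 ^ e)) E) (reverse-map (2 ^_) D)) ⟩
  sortDesc (reverse X)                          ≡⟨ sortDesc-ascending (reverse X) (reverse⁺ decreasing) ⟩
  reverse (reverse X)                           ≡⟨ reverse-involutive X ⟩
  X                                             ∎
  where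
  n : ℕ
  n = sum X
  E : List ℕ
  E = reverse D
  E-ascending : Linked _<_ E
  E-ascending = reverse⁺ (Linked.map 2^-cancel-< (Linked.map⁻ decreasing))
  sum-E : sum (map (2 ^_) E) ≡ n
  sum-E = trans (cong sum (reverse-map (2 ^_) D)) (sum-↭ (↭-reverse X))
  bound : sum (map (2 ^_) E) < 2 ^ n
  bound = subst (_< 2 ^ n) (sym sum-E) (n<2^n n)

Pow2⇒isPow2 : ∀ {x} → Pow2 x → ∃ λ (k : Fin (suc x)) → x ≡ 2 ^ toℕ k
Pow2⇒isPow2 (k , refl) = fromℕ< k<1+2^k , cong (2 ^_) (sym (toℕ-fromℕ< k<1+2^k))
  where
  k<1+2^k : k < suc (2 ^ k)
  k<1+2^k = m<n⇒m<1+n (n<2^n k)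

coprime-∣-pow : ∀ {a b} → Coprime a b → ∀ k → a ∣ b ^ k → a ≡ 1
coprime-∣-pow a⊥b zero    a∣1    = ∣1⇒≡1 a∣1
coprime-∣-pow a⊥b (suc k) a∣b^k+1 = coprime-∣-pow a⊥b k (coprime-divisor a⊥b a∣b^k+1)

chain-with-one : ∀ {l} → All (1 <_) l → Linked ChainRel l → Linked ChainRel (l ++ [ 1 ])
chain-with-one parts>1 lk = Linked-snoc lk (All.map (λ {y} 1<y → 1<y , 1∣ y) parts>1)

binary-increment : List ℕ → List ℕ
binary-increment l = sortDesc (filter (λ x → ¬? (isPow2? x)) l ++ binExp (suc (binaryAmount l)))

module BinaryChains (r : ℕ) (1<r : 1 < r) (2⊥r : Coprime 2 r) where

  pow2-divisor : ∀ {x y} → IsPQ 2 r y → Pow2 x → y ∣ x → Pow2 y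
  pow2-divisor (a , zero  , refl) _          _   = a , *-identityʳ (2 ^ a)
  pow2-divisor (a , suc b , refl) (k , refl) y∣x =
    contradiction (coprime-∣-pow (Coprimality.sym 2⊥r) k r∣2^k) (>⇒≢ 1<r)
    where
    r∣2^k : r ∣ 2 ^ k
    r∣2^k = ∣-trans (∣-trans (m∣m*n (r ^ b)) (n∣m*n (2 ^ a))) y∣x

  pow2-tail : ∀ {x xs} → Pow2 x → All (IsPQ 2 r) xs → Linked ChainRel (x ∷ xs) → All Pow2 (x ∷ xs)
  pow2-tail px []         _              = px ∷ []
  pow2-tail px (py ∷ pys) ((_ , y∣x) ∷ l) = px ∷ pow2-tail (pow2-divisor py px y∣x) pys l

  -- For a partition with parts > 1, the ^1 operation for min(p,q) = 2 appends a part 1: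
  -- the non-binary parts come first, and increasing the binary amount by 1
  -- adds exactly the part 1 to the binary parts.
  one-binary : ∀ l → All (1 <_) l → All (IsPQ 2 r) l → Linked ChainRel l →
               binary-increment l ≡ l ++ [ 1 ]
  one-binary []       _          _          _  = refl
  one-binary (x ∷ xs) (1<x ∷ gs) (px ∷ pxs) lk with isPow2? x
  ... | yes (k , x≡2^k) = begin
    binary-increment l
      ≡⟨ cong₂ (λ ys n → sortDesc (ys ++ binExp (suc n)))
               (filter-none (λ x → ¬? (isPow2? x)) (All.map (λ p ¬p → ¬p (Pow2⇒isPow2 p)) pows))
               (cong sum (filter-all isPow2? (All.map Pow2⇒isPow2 pows))) ⟩
    sortDesc (binExp (suc (sum l)))
      ≡⟨ cong (sortDesc ∘′ binExp) sum-with-one ⟩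
    sortDesc (binExp (sum (l ++ [ 1 ])))
      ≡⟨ binExp-powers (l ++ [ 1 ]) (All.++⁺ pows ((0 , refl) ∷ [])) decreasing ⟩
    l ++ [ 1 ] ∎
    where
    l : List ℕ
    l = x ∷ xs
    pows : All Pow2 l
    pows = pow2-tail (toℕ k , x≡2^k) pxs lk
    decreasing : Linked _>_ (l ++ [ 1 ])
    decreasing = Linked.map proj₁ (chain-with-one (1<x ∷ gs) lk)
    sum-with-one : suc (sum l) ≡ sum (l ++ [ 1 ])
    sum-with-one = trans (+-comm 1 (sum l)) (sym (sum-++ l [ 1 ]))
  ... | no ¬pow = begin
    binary-increment (x ∷ xs)
      ≡⟨ cong₂ (λ ys n → sortDesc (ys ++ binExp (suc n)))
               (filter-accept (λ x → ¬? (isPow2? x)) ¬pow) (cong sum (filter-reject isPow2? ¬pow)) ⟩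
    insertDesc x (binary-increment xs)
      ≡⟨ cong (insertDesc x) (one-binary xs gs pxs (Linked.tail lk)) ⟩
    insertDesc x (xs ++ [ 1 ])
      ≡⟨ insertDesc-front x (xs ++ [ 1 ]) (head-relates (flip <-trans) decreasing) ⟩
    x ∷ xs ++ [ 1 ] ∎
    where
    decreasing : Linked _>_ (x ∷ xs ++ [ 1 ])
    decreasing = Linked.map proj₁ (chain-with-one (1<x ∷ gs) lk)

IsPQ-swap : ∀ {p q x} → IsPQ p q x → IsPQ q p x
IsPQ-swap {p} {q} (a , b , refl) = b , a , *-comm (p ^ a) (q ^ b)

IsPQ-times : ∀ {p q y} → IsPQ p q y → IsPQ p q (p * y)
IsPQ-times {p} {q} (a , b , refl) = suc a , b , sym (*-assoc p (p ^ a) (q ^ b))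

-- ... and so does dividing by p, as p does not divide any power of the coprime q.
IsPQ-divide : ∀ {p q y} → 1 < p → Coprime p q → IsPQ p q (p * y) → IsPQ p q y
IsPQ-divide {p} {q} {y} 1<p p⊥q (zero , b , p*y≡q^b) =
  contradiction (coprime-∣-pow p⊥q b p∣q^b) (>⇒≢ 1<p)
  where
  p∣q^b : p ∣ q ^ b
  p∣q^b = divides y (trans (sym (*-identityˡ (q ^ b))) (trans (sym p*y≡q^b) (*-comm p y)))
IsPQ-divide {p} {q} {y} 1<p p⊥q (suc a , b , p*y≡) =
  a , b , *-cancelˡ-≡ y (p ^ a * q ^ b) p {{>-nonZero (<-trans z<s 1<p)}} (trans p*y≡ (*-assoc p (p ^ a) (q ^ b)))

no-one : ∀ {l} → All (1 <_) l → ¬ (1 ∈ l)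
no-one parts>1 1∈l = <-irrefl refl (All.lookup parts>1 1∈l)

above-one : ∀ {l} → All (0 <_) l → ¬ (1 ∈ l) → All (1 <_) l
above-one pos 1∉l = All.tabulate λ x∈l →
  ≤∧≢⇒< (All.lookup pos x∈l) (λ 1≡x → 1∉l (subst (_∈ _) (sym 1≡x) x∈l))

one-appends-one : ∀ {p q l} → 1 < p → 1 < q → Coprime p q →
                  All (1 <_) l → All (IsPQ p q) l → Linked ChainRel l → one p q l ≡ l ++ [ 1 ]
one-appends-one {p} {q} {l} 1<p 1<q p⊥q parts>1 pq lk = by-cases (p ⊓ q ≟ 2)
  where
  by-cases : (min≟2 : Dec (p ⊓ q ≡ 2)) →
             (if does min≟2 then binary-increment l else l ++ [ 1 ]) ≡ l ++ [ 1 ]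
  by-cases (no _) = refl
  by-cases (yes min≡2) with ⊓-sel p q
  ... | inj₁ min≡p with trans (sym min≡p) min≡2
  ...   | refl = BinaryChains.one-binary q 1<q p⊥q l parts>1 pq lk
  by-cases (yes min≡2) | inj₂ min≡q with trans (sym min≡q) min≡2
  ...   | refl = BinaryChains.one-binary p 1<p (Coprimality.sym p⊥q) l parts>1 (All.map IsPQ-swap pq) lk

-- Multiplying all parts by a factor r > 1 that preserves and reflects being a
-- (p,q)-number maps Ω(n) bijectively onto the partitions of r·n with all parts divisible by r.
module Scaling (p q r : ℕ) (1<r : 1 < r)
               (times  : ∀ {y} → IsPQ p q y → IsPQ p q (r * y))
               (divide : ∀ {y} → IsPQ p q (r * y) → IsPQ p q y) where

  instance
    r≢0 : NonZero r
    r≢0 = >-nonZero (<-trans z<s 1<r)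

  scaled-part>1 : ∀ {y} → 0 < y → 1 < r * y
  scaled-part>1 {suc y} _ = <-≤-trans 1<r (m≤m*n r (suc y))

  unscaled-part>0 : ∀ {y} → 0 < r * y → 0 < y
  unscaled-part>0 {y} 0<ry = >-nonZero⁻¹ y {{m*n≢0⇒n≢0 r {{>-nonZero 0<ry}}}}

  scale-SCP : ∀ {n l} → SCP p q n l → SCP p q (r * n) (scale r l)
  scale-SCP {l = l} (pos , pq , lk , sum≡n) =
    All.map⁺ (All.map (<-trans z<s ∘′ scaled-part>1) pos) ,
    All.map⁺ (All.map times pq) ,
    Linked.map⁺ (Linked.map (λ (y<x , y∣x) → *-monoʳ-< r y<x , *-monoʳ-∣ r y∣x) lk) ,
    trans (sum-scale r l) (cong (r *_) sum≡n)

  unscale-SCP : ∀ {n l} → SCP p q n (scale r l) → SCP p q (sum l) l × n ≡ r * sum l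
  unscale-SCP {l = l} (pos , pq , lk , sum≡n) =
    (All.map unscaled-part>0 (All.map⁻ pos) ,
     All.map divide (All.map⁻ pq) ,
     Linked.map (λ (y<x , y∣x) → *-cancelˡ-< r _ _ y<x , *-cancelˡ-∣ r y∣x) (Linked.map⁻ lk) ,
     refl) ,
    trans (sym sum≡n) (sum-scale r l)

  unscale : ∀ {l} → All (r ∣_) l → Σ (List ℕ) λ l′ → l ≡ scale r l′
  unscale []                    = [] , refl
  unscale (divides k x≡kr ∷ ds) =
    k ∷ proj₁ (unscale ds) , cong₂ _∷_ (trans x≡kr (*-comm k r)) (proj₂ (unscale ds))

  scaled⇒Ω* : ∀ {U l} → Image (scale r) (ΩDiv p q U r) l → Ω* p q U l
  scaled⇒Ω* (l′ , (n , U≡rn , scp) , refl) =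
    (r * n , U≡rn , scale-SCP scp) , no-one (All.map⁺ (All.map scaled-part>1 (proj₁ scp)))

  divisible⇒scaled : ∀ {U l} → All (r ∣_) l → Ω p q U l → Image (scale r) (ΩDiv p q U r) l
  divisible⇒scaled ds (n , U≡n , scp) with unscale ds
  ... | l′ , refl with unscale-SCP scp
  ...   | scp′ , n≡r*sum = l′ , (sum l′ , trans U≡n (cong +_ n≡r*sum) , scp′) , refl

-- In a strictly chained partition every part is a multiple of the smallest one;
-- if no part is 1, that part is divisible by p or by q, hence so are all parts.
common-factor : ∀ {p q} l → All (IsPQ p q) l → Linked ChainRel l → ¬ (1 ∈ l) →
                All (p ∣_) l ⊎ All (q ∣_) l
common-factor []      _  _ _ = inj₁ []
common-factor {p} {q} (x ∷ []) ((suc a , b , refl) ∷ []) _ _ =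
  inj₁ (∣-trans (m∣m*n (p ^ a)) (m∣m*n (q ^ b)) ∷ [])
common-factor {p} {q} (x ∷ []) ((zero , suc b , refl) ∷ []) _ _ =
  inj₂ (∣-trans (m∣m*n (q ^ b)) (n∣m*n (p ^ 0)) ∷ [])
common-factor (x ∷ []) ((zero , zero , refl) ∷ []) _ 1∉l = contradiction (here refl) 1∉l
common-factor (x ∷ y ∷ ys) (_ ∷ pq) ((_ , y∣x) ∷ lk) 1∉l
  with common-factor (y ∷ ys) pq lk (1∉l ∘′ there)
... | inj₁ (p∣y ∷ ps) = inj₁ (∣-trans p∣y y∣x ∷ p∣y ∷ ps)
... | inj₂ (q∣y ∷ qs) = inj₂ (∣-trans q∣y y∣x ∷ q∣y ∷ qs)

ends-with-one : ∀ l → All (0 <_) l → Linked _>_ l → 1 ∈ l →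
                Σ (List ℕ) λ l′ → l ≡ l′ ++ [ 1 ] × All (1 <_) l′
ends-with-one (x ∷ [])     _             _         (here refl)  = [] , refl , []
ends-with-one (x ∷ y ∷ ys) (_ ∷ 0<y ∷ _) (y<1 ∷ _) (here refl)  = contradiction 0<y (<⇒≱ y<1)
ends-with-one (x ∷ xs)     (_ ∷ pos)     lk        (there 1∈xs)
  with ends-with-one xs pos (Linked.tail lk) 1∈xs
... | l′ , refl , parts>1 with All.++⁻ʳ l′ (head-relates (flip <-trans) lk)
...   | 1<x ∷ [] = x ∷ l′ , refl , 1<x ∷ parts>1

SCP-with-one : ∀ {p q n l} → SCP p q n l → All (1 <_) l → SCP p q (suc n) (l ++ [ 1 ])
SCP-with-one {l = l} (pos , pq , lk , sum≡n) parts>1 =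
  All.++⁺ pos (z<s ∷ []) ,
  All.++⁺ pq ((0 , 0 , refl) ∷ []) ,
  chain-with-one parts>1 lk ,
  trans (sum-++ l [ 1 ]) (trans (+-comm (sum l) 1) (cong suc sum≡n))

SCP-without-one : ∀ {p q n} l → SCP p q n (l ++ [ 1 ]) → SCP p q (sum l) l × n ≡ suc (sum l)
SCP-without-one l (pos , pq , lk , sum≡n) =
  (All.++⁻ˡ l pos , All.++⁻ˡ l pq , Linked-prefix l lk , refl) ,
  trans (sym sum≡n) (trans (sum-++ l [ 1 ]) (+-comm (sum l) 1))

minus-one⇒ : ∀ U n → U - + 1 ≡ + n → U ≡ + suc n
minus-one⇒ (+ suc n) .n refl = refl
minus-one⇒ (+ zero)  n ()
minus-one⇒ -[1+ _ ]  n ()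

minus-one⇐ : ∀ U n → U ≡ + suc n → U - + 1 ≡ + n
minus-one⇐ _ n refl = refl

module Lemma2p1 (p q : ℕ) (1<p : 1 < p) (1<q : 1 < q) (p⊥q : Coprime p q) where

  module P = Scaling p q p 1<p IsPQ-times (IsPQ-divide 1<p p⊥q)
  module Q = Scaling p q q 1<q (IsPQ-swap ∘′ IsPQ-times ∘′ IsPQ-swap)
                               (IsPQ-swap ∘′ IsPQ-divide 1<q (Coprimality.sym p⊥q) ∘′ IsPQ-swap)

  one-on-Ω* : ∀ {U l} → Ω* p q U l → one p q l ≡ l ++ [ 1 ]
  one-on-Ω* ((_ , _ , pos , pq , lk , _) , 1∉l) = one-appends-one 1<p 1<q p⊥q (above-one pos 1∉l) pq lk

  -- Ω(U) = Ω*(U) + ^1Ω*(U-1): a partition either avoids 1 or ends with 1 ...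
  Ω-split : ∀ {U l} → Ω p q U l → (Ω* p q U ∪ Image (one p q) (Ω* p q (U - + 1))) l
  Ω-split {U} {l} ω@(n , U≡n , scp@(pos , _ , lk , _)) with 1 ∈? l
  ... | no 1∉l = inj₁ (ω , 1∉l)
  ... | yes 1∈l with ends-with-one l pos (Linked.map proj₁ lk) 1∈l
  ...   | l′ , refl , parts>1 = inj₂ (l′ , ω′ , sym (one-on-Ω* ω′))
    where
    stripped : SCP p q (sum l′) l′ × n ≡ suc (sum l′)
    stripped = SCP-without-one l′ scp
    ω′ : Ω* p q (U - + 1) l′
    ω′ = (sum l′ , minus-one⇐ U (sum l′) (trans U≡n (cong +_ (proj₂ stripped))) , proj₁ stripped) ,
         no-one parts>1

  Ω-join : ∀ {U l} → (Ω* p q U ∪ Image (one p q) (Ω* p q (U - + 1))) l → Ω p q U l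
  Ω-join (inj₁ (ω , _)) = ω
  Ω-join {U} (inj₂ (l′ , ω*@((n , U-1≡n , scp) , 1∉l′) , refl)) =
    subst (Ω p q U) (sym (one-on-Ω* ω*))
      (suc n , minus-one⇒ U n U-1≡n , SCP-with-one scp (above-one (proj₁ scp) 1∉l′))

  Ω-disjoint : ∀ {U l} → ¬ (Ω* p q U l × Image (one p q) (Ω* p q (U - + 1)) l)
  Ω-disjoint ((_ , 1∉l) , (l′ , ω* , refl)) =
    1∉l (subst (1 ∈_) (sym (one-on-Ω* ω*)) (∈-++⁺ʳ l′ (here refl)))

  Ω*-split : ∀ {U l} → Ω* p q U l → (Image (scale p) (ΩDiv p q U p) ∪ Image (scale q) (ΩDiv p q U q)) l
  Ω*-split {l = l} (ω@(_ , _ , _ , pq , lk , _) , 1∉l) with common-factor l pq lk 1∉l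
  ... | inj₁ p∣parts = inj₁ (P.divisible⇒scaled p∣parts ω)
  ... | inj₂ q∣parts = inj₂ (Q.divisible⇒scaled q∣parts ω)

  Ω*-join : ∀ {U l} → (Image (scale p) (ΩDiv p q U p) ∪ Image (scale q) (ΩDiv p q U q)) l → Ω* p q U l
  Ω*-join (inj₁ scaled-by-p) = P.scaled⇒Ω* scaled-by-p
  Ω*-join (inj₂ scaled-by-q) = Q.scaled⇒Ω* scaled-by-q

lemma2p1 : (p q : ℕ) → 1 < p → 1 < q → Coprime p q → (U : ℤ) →
    IsDisjointUnion (Ω p q U) (Ω* p q U) (Image (one p q) (Ω* p q (U - + 1)))
    × (Ω* p q U ≐ (Image (scale p) (ΩDiv p q U p) ∪ Image (scale q) (ΩDiv p q U q)))
lemma2p1 p q 1<p 1<q p⊥q U =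
  ((λ l → Ω-split , Ω-join) , λ l → Ω-disjoint) ,
  (λ l → Ω*-split , Ω*-join)
  where open Lemma2p1 p q 1<p 1<q p⊥q
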